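{- Let $\mathcal T=\{(P_1,B_1),\dots,(P_r,B_r)\}$ be a finite set of templates such that each binary string $B_i$ contains at most $k$ zeros, and let $\sigma$ be a pattern (permutation) of length $l>0$. If there exists $n$ such that $S_{n,\mathcal T}$ contains a permutation containing $\sigma$ as a pattern, then there exists $m\le (l-1)(k+1)+1$ such that $S_{m,\mathcal T}$ contains a permutation containing $\sigma$ as a pattern.
   Context: A permutation $\pi$ contains a pattern $\sigma$ if some subsequence of $\pi$ is order-isomorphic to $\sigma$. A template of length $t\ge1$ is a pair $T=(P,B)$ where $P=p_1\cdots p_t$ is a permutation of $\{1,\dots,t\}$ and $B=b_1\cdots b_t$ is a binary string of length $t$. For a set $\mathcal T$ of templates, the sets $S_{n,\mathcal T}$ of permutations of length $n$ are defined recursively: $S_{0,\mathcal T}$ consists of the empty permutation and $S_{1,\mathcal T}=\{1\}$; for $n\ge2$, $S_{n,\mathcal T}$ is the set of permutations $\pi$ of length $n$ for which there is some template $T=(P,B)\in\mathcal T$ of length $t$ such that $\pi$ can be divided into consecutive (possibly empty) subwords $W_1,\dots,W_t$ (so $\pi=W_1W_2\cdots W_t$) with: whenever $p_i>p_j$, every entry of $W_i$ is greater than every entry of $W_j$; each $W_i$ of length $l$, viewed up to order-isomorphism (standardized to a permutation of $\{1,\dots,l\}$), is an element of $S_{l,\mathcal T}$; and whenever $b_i=0$, $W_i$ has exactly one element. -}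

module Defs where

open import Data.Nat using (ℕ; zero; suc; _+_; _<_; _>_; _≤_)
open import Data.Bool using (Bool; true; false)
open import Data.Fin using (Fin; cast)
open import Data.List using (List; []; _∷_; length; map; upTo; concat)
open import Data.List.Relation.Unary.All using (All)
open import Data.List.Relation.Binary.Permutation.Propositional using (_↭_)
open import Data.List.Relation.Binary.Sublist.Propositional using (_⊆_)
open import Data.List.Membership.Propositional using (_∈_)
open import Data.Vec using (Vec; toList) renaming (lookup to vlookup)
open import Data.List using (lookup)
open import Data.Product using (Σ; _×_; ∃; ∃-syntax)
open import Relation.Binary.PropositionalEquality using (_≡_)

IsPerm : ℕ → List ℕ → Set
IsPerm n π = π ↭ map suc (upTo n)

OrdIso : List ℕ → List ℕ → Set
OrdIso u v = Σ (length u ≡ length v) λ e →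
  ∀ (i j : Fin (length u)) →
    ((lookup u i < lookup u j) → (lookup v (cast e i) < lookup v (cast e j))) ×
    ((lookup v (cast e i) < lookup v (cast e j)) → (lookup u i < lookup u j))

Contains : List ℕ → List ℕ → Set
Contains π σ = ∃[ τ ] (τ ⊆ π × OrdIso τ σ)

-- A template (P , B) of length t ≥ 1; P a permutation of {1..t}, B a binary
-- string of length t (bit 0 is represented by false, bit 1 by true).
record Template : Set where
  field
    t    : ℕ
    t≥1  : 1 ≤ t
    P    : Vec ℕ t
    Pperm : IsPerm t (toList P)
    B    : Vec Bool t

zeros : List Bool → ℕ
zeros [] = 0
zeros (false ∷ bs) = suc (zeros bs)
zeros (true ∷ bs) = zeros bs

data InS (𝒯 : List Template) : ℕ → List ℕ → Set where
  s0 : InS 𝒯 0 []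
  s1 : InS 𝒯 1 (1 ∷ [])
  sT : ∀ {n π} → 2 ≤ n → IsPerm n π →
       (T : Template) → T ∈ 𝒯 →
       (W : Vec (List ℕ) (Template.t T)) →
       concat (toList W) ≡ π →
       (∀ i j → vlookup (Template.P T) i > vlookup (Template.P T) j →
          All (λ x → All (λ y → y < x) (vlookup W j)) (vlookup W i)) →
       (∀ i → Σ (List ℕ) λ σ → IsPerm (length (vlookup W i)) σ ×
                OrdIso (vlookup W i) σ × InS 𝒯 (length (vlookup W i)) σ) →
       (∀ i → vlookup (Template.B T) i ≡ false → length (vlookup W i) ≡ 1) →
       InS 𝒯 n π

-- Call a word realizable when its pattern lies in S_𝒯.  The main lemma (`extend`): for
-- π ∈ S_n and j ≥ 1 selected entries of π, some realizable subsequence of π contains them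
-- and has at most (k + 1)j − k entries.  For π = W_1 ⋯ W_t built from a template, every block holding selected entries
-- is extended by induction, saving k against the trivial bound (k + 1)j_i.  If only one
-- block is involved its extension is the answer.  Otherwise the chosen sub-blocks, together
-- with the single entry of every zero-bit block, decompose along the same template again
-- (`assemble`), and the at most k extra entries are paid for by the savings of the (at
-- least two) extended blocks.  Applied to an occurrence of σ this gives the theorem, as
-- containment of a pattern is invariant under order-isomorphism.
module Submission where

open import Defs
open import Data.Nat using (ℕ; zero; suc; _+_; _*_; _∸_; _<_; _≤_; _>_; z≤n; s≤s; s≤s⁻¹; _<?_; _≤?_)
open import Data.Nat.Properties
open import Data.Bool using (Bool; true; false; f≤t; b≤b) renaming (_≤_ to _≤ᵇ_)
open import Data.Product using (Σ; _×_; _,_; proj₁; proj₂; swap; ∃-syntax)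
open import Data.Sum using (_⊎_; inj₁; inj₂)
open import Data.Fin using (Fin; cast) renaming (zero to fzero; suc to fsuc)
import Data.Fin.Properties as Fin
open import Data.Vec using (Vec; toList; tabulate) renaming ([] to []ᵛ; _∷_ to _∷ᵛ_; lookup to vlookup)
open import Data.Vec.Properties using (lookup∘tabulate)
open import Data.Vec.Functional using () renaming (_∷_ to _∷ᶠ_)
open import Algebra.Properties.Semiring.Sum +-*-semiring
  using (sum; sum-cong-≗; sum-replicate-zero; ∑-distrib-+; *-distribʳ-sum)
open import Data.List using (List; []; _∷_; _++_; length; map; concat; replicate; upTo; zipWith; lookup)
open import Data.List.Properties
  using (∷-injective; length-map; map-∘; map-id; length-++; length-replicate; length-upTo; map-++; ++-identityʳ)
open import Data.List.Membership.Propositional using (_∈_)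
open import Data.List.Membership.Propositional.Properties
  using (∈-map⁺; ∈-map⁻; ∈-∃++; ∈-++⁻; ∈-++⁺ˡ; ∈-++⁺ʳ; ∈-upTo⁺)
open import Data.List.Relation.Unary.Any using (here; there)
open import Data.List.Relation.Unary.All using (All; []; _∷_)
import Data.List.Relation.Unary.All as All
import Data.List.Relation.Unary.All.Properties as All
open import Data.List.Relation.Unary.AllPairs using ([]; _∷_)
open import Data.List.Relation.Unary.Unique.Propositional using (Unique)
import Data.List.Relation.Unary.Unique.Propositional.Properties as Unique
open import Data.List.Relation.Binary.Pointwise using (Pointwise; []; _∷_)
import Data.List.Relation.Binary.Pointwise as Pointwise
open import Data.List.Relation.Binary.Sublist.Propositional using (_⊆_; []; _∷_; _∷ʳ_; minimum)
open import Data.List.Relation.Binary.Sublist.Propositional.Properties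
  using (Any-resp-⊆; All-resp-⊆; length-mono-≤)
import Data.List.Relation.Binary.Sublist.Propositional.Properties as Sublist
open import Data.List.Relation.Binary.Permutation.Propositional
  using (_↭_; ↭-refl; ↭-sym; ↭-trans; prep; ↭⇒↭ₛ)
open import Data.List.Relation.Binary.Permutation.Propositional.Properties using (shift; ↭-length)
import Data.List.Relation.Binary.Permutation.Setoid.Properties as PermutationSetoid
open import Function using (_∘_; id)
open import Relation.Binary using (tri<; tri≈; tri>)
open import Relation.Binary.PropositionalEquality
open import Relation.Nullary using (¬_; yes; no; contradiction)

private
  variable
    A B : Set

select : List Bool → List A → List A
select _           []       = []
select []          (x ∷ xs) = []
select (true  ∷ m) (x ∷ xs) = x ∷ select m xs
select (false ∷ m) (x ∷ xs) = select m xs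

select-⊆ : ∀ m (xs : List A) → select m xs ⊆ xs
select-⊆ _           []       = []
select-⊆ []          (x ∷ xs) = minimum (x ∷ xs)
select-⊆ (true  ∷ m) (x ∷ xs) = refl ∷ select-⊆ m xs
select-⊆ (false ∷ m) (x ∷ xs) = x ∷ʳ select-⊆ m xs

select-map : ∀ (f : A → B) m xs → select m (map f xs) ≡ map f (select m xs)
select-map f _           []       = refl
select-map f []          (x ∷ xs) = refl
select-map f (true  ∷ m) (x ∷ xs) = cong (f x ∷_) (select-map f m xs)
select-map f (false ∷ m) (x ∷ xs) = select-map f m xs

select-++ : ∀ m₁ m₂ (xs₁ xs₂ : List A) → length m₁ ≡ length xs₁ →
  select (m₁ ++ m₂) (xs₁ ++ xs₂) ≡ select m₁ xs₁ ++ select m₂ xs₂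
select-++ []          m₂ []        xs₂ e = refl
select-++ (true  ∷ m) m₂ (x ∷ xs₁) xs₂ e = cong (x ∷_) (select-++ m m₂ xs₁ xs₂ (suc-injective e))
select-++ (false ∷ m) m₂ (x ∷ xs₁) xs₂ e = select-++ m m₂ xs₁ xs₂ (suc-injective e)

full : ℕ → List Bool
full n = replicate n true

select-full : (xs : List A) → select (full (length xs)) xs ≡ xs
select-full []       = refl
select-full (x ∷ xs) = cong (x ∷_) (select-full xs)

⊆⇒select : {τ π : List A} → τ ⊆ π → Σ (List Bool) λ m → length m ≡ length π × select m π ≡ τ
⊆⇒select []         = [] , refl , refl
⊆⇒select (y ∷ʳ sub) with ⊆⇒select sub
... | m , len , sel = false ∷ m , cong suc len , sel
⊆⇒select (refl ∷ sub) with ⊆⇒select sub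
... | m , len , sel = true ∷ m , cong suc len , cong (_ ∷_) sel

_⊑_ : List Bool → List Bool → Set
_⊑_ = Pointwise _≤ᵇ_

⊑-refl : ∀ m → m ⊑ m
⊑-refl []      = []
⊑-refl (b ∷ m) = b≤b ∷ ⊑-refl m

⊑-full : ∀ m → m ⊑ full (length m)
⊑-full []          = []
⊑-full (true  ∷ m) = b≤b ∷ ⊑-full m
⊑-full (false ∷ m) = f≤t ∷ ⊑-full m

select-⊑ : ∀ {m m′} → m ⊑ m′ → (xs : List A) → select m xs ⊆ select m′ xs
select-⊑ _                 []       = []
select-⊑ []                (x ∷ xs) = []
select-⊑ (b≤b {true} ∷ le) (x ∷ xs) = refl ∷ select-⊑ le xs
select-⊑ (b≤b {false} ∷ le) (x ∷ xs) = select-⊑ le xs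
select-⊑ (f≤t ∷ le)        (x ∷ xs) = x ∷ʳ select-⊑ le xs

Monotone : List (ℕ × ℕ) → Set
Monotone ps = ∀ {p q} → p ∈ ps → q ∈ ps →
  (proj₁ p < proj₁ q → proj₂ p < proj₂ q) × (proj₂ p < proj₂ q → proj₁ p < proj₁ q)

-- Order-isomorphism witnessed positionally: a monotone list of pairs whose first and second
-- components are u and v.  Unlike the index-based `OrdIso`, it commutes with masks.
record _≅_ (u v : List ℕ) : Set where
  constructor iso
  field
    pairs    : List (ℕ × ℕ)
    fst≡     : map proj₁ pairs ≡ u
    snd≡     : map proj₂ pairs ≡ v
    monotone : Monotone pairs

≅-length : ∀ {u v} → u ≅ v → length u ≡ length v
≅-length (iso ps refl refl _) = trans (length-map proj₁ ps) (sym (length-map proj₂ ps))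

EmbeddingOn : (ℕ → ℕ) → List ℕ → Set
EmbeddingOn f xs = ∀ {x y} → x ∈ xs → y ∈ xs → (x < y → f x < f y) × (f x < f y → x < y)

EmbeddingOn-⊆ : ∀ {f xs ys} → (∀ {x} → x ∈ ys → x ∈ xs) → EmbeddingOn f xs → EmbeddingOn f ys
EmbeddingOn-⊆ sub emb x∈ y∈ = emb (sub x∈) (sub y∈)

≅-map : ∀ f xs → EmbeddingOn f xs → xs ≅ map f xs
≅-map f xs emb = iso (map (λ x → x , f x) xs) fst snd mono
  where
  fst : map proj₁ (map (λ x → x , f x) xs) ≡ xs
  fst = trans (sym (map-∘ xs)) (map-id xs)
  snd : map proj₂ (map (λ x → x , f x) xs) ≡ map f xs
  snd = sym (map-∘ xs)
  mono : Monotone (map (λ x → x , f x) xs)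
  mono pm qm with ∈-map⁻ (λ x → x , f x) pm | ∈-map⁻ (λ x → x , f x) qm
  ... | x , xm , refl | y , ym , refl = emb xm ym

≅-refl : ∀ u → u ≅ u
≅-refl u = subst (u ≅_) (map-id u) (≅-map id u (λ _ _ → id , id))

≅-sym : ∀ {u v} → u ≅ v → v ≅ u
≅-sym (iso ps fst snd mono) =
  iso (map swap ps) (trans (sym (map-∘ ps)) snd) (trans (sym (map-∘ ps)) fst) mono-swap
  where
  mono-swap : Monotone (map swap ps)
  mono-swap pm qm with ∈-map⁻ swap pm | ∈-map⁻ swap qm
  ... | p , p∈ , refl | q , q∈ , refl = swap (mono p∈ q∈)

≅-select : ∀ {u v} m → u ≅ v → select m u ≅ select m v
≅-select m (iso ps refl refl mono) =
  iso (select m ps) (sym (select-map proj₁ m ps)) (sym (select-map proj₂ m ps))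
      (λ pm qm → mono (Any-resp-⊆ (select-⊆ m ps) pm) (Any-resp-⊆ (select-⊆ m ps) qm))

compose : List (ℕ × ℕ) → List (ℕ × ℕ) → List (ℕ × ℕ)
compose = zipWith (λ p q → proj₁ p , proj₂ q)

Matching : List (ℕ × ℕ) → List (ℕ × ℕ) → Set
Matching ps qs = map proj₂ ps ≡ map proj₁ qs

compose-fst : ∀ ps qs → Matching ps qs → map proj₁ (compose ps qs) ≡ map proj₁ ps
compose-fst []       []       e = refl
compose-fst (p ∷ ps) (q ∷ qs) e = cong (proj₁ p ∷_) (compose-fst ps qs (proj₂ (∷-injective e)))

compose-snd : ∀ ps qs → Matching ps qs → map proj₂ (compose ps qs) ≡ map proj₂ qs
compose-snd []       []       e = refl
compose-snd (p ∷ ps) (q ∷ qs) e = cong (proj₂ q ∷_) (compose-snd ps qs (proj₂ (∷-injective e)))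

compose-∈ : ∀ ps qs → Matching ps qs → ∀ {r} → r ∈ compose ps qs →
  Σ (ℕ × ℕ) λ p → Σ (ℕ × ℕ) λ q →
    p ∈ ps × q ∈ qs × proj₂ p ≡ proj₁ q × r ≡ (proj₁ p , proj₂ q)
compose-∈ (p ∷ ps) (q ∷ qs) e (here refl) = p , q , here refl , here refl , proj₁ (∷-injective e) , refl
compose-∈ (p ∷ ps) (q ∷ qs) e (there r∈) with compose-∈ ps qs (proj₂ (∷-injective e)) r∈
... | p′ , q′ , p∈ , q∈ , mid , r≡ = p′ , q′ , there p∈ , there q∈ , mid , r≡

≅-trans : ∀ {u v w} → u ≅ v → v ≅ w → u ≅ w
≅-trans (iso ps fst snd mono) (iso qs fst′ snd′ mono′) =
  iso (compose ps qs) (trans (compose-fst ps qs match) fst) (trans (compose-snd ps qs match) snd′) mono″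
  where
  match : Matching ps qs
  match = trans snd (sym fst′)
  mono″ : Monotone (compose ps qs)
  mono″ r∈ s∈ with compose-∈ ps qs match r∈ | compose-∈ ps qs match s∈
  ... | p , q , p∈ , q∈ , refl , refl | p′ , q′ , p∈′ , q∈′ , refl , refl =
    (λ lt → proj₁ (mono′ q∈ q∈′) (proj₁ (mono p∈ p∈′) lt)) ,
    (λ lt → proj₂ (mono p∈ p∈′) (proj₂ (mono′ q∈ q∈′) lt))

lookup-pairs : ∀ (ps : List (ℕ × ℕ)) .(e : length (map proj₁ ps) ≡ length (map proj₂ ps))
  (i : Fin (length (map proj₁ ps))) →
  (lookup (map proj₁ ps) i , lookup (map proj₂ ps) (cast e i)) ∈ ps
lookup-pairs (p ∷ ps) e fzero    = here refl
lookup-pairs (p ∷ ps) e (fsuc i) = there (lookup-pairs ps (suc-injective e) i)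

≅⇒OrdIso : ∀ {u v} → u ≅ v → OrdIso u v
≅⇒OrdIso u≅v@(iso ps refl refl mono) =
  ≅-length u≅v , λ i j → mono (lookup-pairs ps (≅-length u≅v) i) (lookup-pairs ps (≅-length u≅v) j)

∈-zip : ∀ (u v : List ℕ) .(e : length u ≡ length v) {p} → p ∈ zipWith _,_ u v →
  Σ (Fin (length u)) λ i → p ≡ (lookup u i , lookup v (cast e i))
∈-zip (x ∷ u) (y ∷ v) e (here refl) = fzero , refl
∈-zip (x ∷ u) (y ∷ v) e (there p∈) with ∈-zip u v (suc-injective e) p∈
... | i , p≡ = fsuc i , p≡

OrdIso⇒≅ : ∀ {u v} → OrdIso u v → u ≅ v
OrdIso⇒≅ {u} {v} (e , ord) = iso (zipWith _,_ u v) (zip-fst u v e) (zip-snd u v e) mono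
  where
  zip-fst : ∀ (u v : List ℕ) → length u ≡ length v → map proj₁ (zipWith _,_ u v) ≡ u
  zip-fst []      []      _  = refl
  zip-fst (x ∷ u) (y ∷ v) e′ = cong (x ∷_) (zip-fst u v (suc-injective e′))
  zip-snd : ∀ (u v : List ℕ) → length u ≡ length v → map proj₂ (zipWith _,_ u v) ≡ v
  zip-snd []      []      _  = refl
  zip-snd (x ∷ u) (y ∷ v) e′ = cong (y ∷_) (zip-snd u v (suc-injective e′))
  mono : Monotone (zipWith _,_ u v)
  mono p∈ q∈ with ∈-zip u v e p∈ | ∈-zip u v e q∈
  ... | i , refl | j , refl = ord i j

below : List ℕ → ℕ → ℕ
below []      x = 0
below (z ∷ w) x with z <? x
... | yes _ = suc (below w x)
... | no  _ = below w x

below-mono : ∀ w {x y} → x ≤ y → below w x ≤ below w y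
below-mono []      le = z≤n
below-mono (z ∷ w) {x} {y} le with z <? x | z <? y
... | yes _   | yes _   = s≤s (below-mono w le)
... | yes z<x | no  z≮y = contradiction (<-≤-trans z<x le) z≮y
... | no  _   | yes _   = m≤n⇒m≤1+n (below-mono w le)
... | no  _   | no  _   = below-mono w le

below-strict : ∀ w {x y} → x < y → x ∈ w → below w x < below w y
below-strict (z ∷ w) {x} {y} x<y x∈ with z <? x | z <? y | x∈
... | yes z<x | _       | here refl = contradiction z<x (<-irrefl refl)
... | no  _   | yes _   | here refl = s≤s (below-mono w (<⇒≤ x<y))
... | _       | no  z≮y | here refl = contradiction x<y z≮y
... | yes _   | yes _   | there x∈′ = s≤s (below-strict w x<y x∈′)
... | yes z<x | no  z≮y | there x∈′ = contradiction (<-trans z<x x<y) z≮y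
... | no  _   | yes _   | there x∈′ = m≤n⇒m≤1+n (below-strict w x<y x∈′)
... | no  _   | no  _   | there x∈′ = below-strict w x<y x∈′

below-≤ : ∀ w x → below w x ≤ length w
below-≤ []      x = z≤n
below-≤ (z ∷ w) x with z <? x
... | yes _ = s≤s (below-≤ w x)
... | no  _ = m≤n⇒m≤1+n (below-≤ w x)

below-< : ∀ w {x} → x ∈ w → below w x < length w
below-< (z ∷ w) {x} x∈ with z <? x | x∈
... | yes z<x | here refl = contradiction z<x (<-irrefl refl)
... | no  _   | here refl = s≤s (below-≤ w x)
... | yes _   | there x∈′ = s≤s (below-< w x∈′)
... | no  _   | there x∈′ = m≤n⇒m≤1+n (below-< w x∈′)

rank : List ℕ → ℕ → ℕ
rank w x = suc (below w x)

rank-embedding : ∀ w → EmbeddingOn (rank w) w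
rank-embedding w {x} {y} x∈ y∈ = (λ x<y → s≤s (below-strict w x<y x∈)) , reflect
  where
  reflect : rank w x < rank w y → x < y
  reflect r< with x <? y
  ... | yes x<y = x<y
  ... | no  x≮y = contradiction (below-mono w (≮⇒≥ x≮y)) (<⇒≱ (s≤s⁻¹ r<))

embedding-injective : ∀ {f xs a b} → EmbeddingOn f xs → a ∈ xs → b ∈ xs → f a ≡ f b → a ≡ b
embedding-injective {a = a} {b} emb a∈ b∈ eq with <-cmp a b
... | tri< a<b _ _ = contradiction eq (<⇒≢ (proj₁ (emb a∈ b∈) a<b))
... | tri≈ _ a≡b _ = a≡b
... | tri> _ _ b<a = contradiction (sym eq) (<⇒≢ (proj₁ (emb b∈ a∈) b<a))

Unique-map : ∀ f xs → EmbeddingOn f xs → Unique xs → Unique (map f xs)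
Unique-map f []       emb []         = []
Unique-map f (x ∷ xs) emb (x∉ ∷ uxs) =
  All.map⁺ (All.tabulate λ y∈ fx≡fy →
    All.lookup x∉ y∈ (embedding-injective emb (here refl) (there y∈) fx≡fy)) ∷
  Unique-map f xs (λ a∈ b∈ → emb (there a∈) (there b∈)) uxs

Unique-resp-↭ : ∀ {xs ys : List ℕ} → xs ↭ ys → Unique xs → Unique ys
Unique-resp-↭ p = PermutationSetoid.Unique-resp-↭ (setoid ℕ) (↭⇒↭ₛ p)

Unique-⊆ : ∀ {xs ys : List ℕ} → xs ⊆ ys → Unique ys → Unique xs
Unique-⊆ []          []          = []
Unique-⊆ (y ∷ʳ sub)  (_ ∷ uys)   = Unique-⊆ sub uys
Unique-⊆ (refl ∷ sub) (y∉ ∷ uys) = All-resp-⊆ sub y∉ ∷ Unique-⊆ sub uys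

pigeonhole : ∀ (xs ys : List ℕ) → Unique xs → (∀ {x} → x ∈ xs → x ∈ ys) → length xs ≡ length ys →
  xs ↭ ys
pigeonhole []       []       _          _   _   = ↭-refl
pigeonhole (x ∷ xs) ys       (x∉ ∷ uxs) sub len with ∈-∃++ (sub (here refl))
... | as , bs , refl = ↭-trans (prep x rest) (↭-sym (shift x as bs))
  where
  drop-x : ∀ {z} → z ∈ as ++ x ∷ bs → z ≢ x → z ∈ as ++ bs
  drop-x {z} z∈ z≢x with ∈-++⁻ as z∈
  ... | inj₁ z∈as          = ∈-++⁺ˡ z∈as
  ... | inj₂ (here z≡x)    = contradiction z≡x z≢x
  ... | inj₂ (there z∈bs)  = ∈-++⁺ʳ as z∈bs
  rest : xs ↭ as ++ bs
  rest = pigeonhole xs (as ++ bs) uxs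
    (λ z∈ → drop-x (sub (there z∈)) (λ z≡x → All.lookup x∉ z∈ (sym z≡x)))
    (suc-injective (trans len (↭-length (shift x as bs))))

perm-unique : ∀ {n π} → IsPerm n π → Unique π
perm-unique {n} perm = Unique-resp-↭ (↭-sym perm) (Unique.map⁺ suc-injective (Unique.upTo⁺ n))

rank-perm : ∀ w → Unique w → IsPerm (length w) (map (rank w) w)
rank-perm w uw = pigeonhole _ _ (Unique-map (rank w) w (rank-embedding w) uw) ranks-in-range lengths
  where
  ranks-in-range : ∀ {r} → r ∈ map (rank w) w → r ∈ map suc (upTo (length w))
  ranks-in-range r∈ with ∈-map⁻ (rank w) r∈
  ... | z , z∈ , refl = ∈-map⁺ suc (∈-upTo⁺ (below-< w z∈))
  lengths : length (map (rank w) w) ≡ length (map suc (upTo (length w)))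
  lengths = trans (length-map (rank w) w) (sym (trans (length-map suc (upTo (length w))) (length-upTo (length w))))

Concat : ∀ {t} → (Fin t → List A) → List A
Concat {t = zero}  f = []
Concat {t = suc t} f = f fzero ++ Concat (f ∘ fsuc)

concat-toList : ∀ {t} (W : Vec (List A) t) → concat (toList W) ≡ Concat (vlookup W)
concat-toList []ᵛ      = refl
concat-toList (w ∷ᵛ W) = cong (w ++_) (concat-toList W)

length-Concat : ∀ {t} (f : Fin t → List A) → length (Concat f) ≡ sum (length ∘ f)
length-Concat {t = zero}  f = refl
length-Concat {t = suc t} f = trans (length-++ (f fzero)) (cong (length (f fzero) +_) (length-Concat (f ∘ fsuc)))

Concat-cong : ∀ {t} {f g : Fin t → List A} → (∀ i → f i ≡ g i) → Concat f ≡ Concat g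
Concat-cong {t = zero}  eq = refl
Concat-cong {t = suc t} eq = cong₂ _++_ (eq fzero) (Concat-cong (eq ∘ fsuc))

length-Concat-cong : ∀ {t} {f : Fin t → List A} {g : Fin t → List B} →
  (∀ i → length (f i) ≡ length (g i)) → length (Concat f) ≡ length (Concat g)
length-Concat-cong {f = f} {g} eq = trans (length-Concat f) (trans (sum-cong-≗ eq) (sym (length-Concat g)))

map-Concat : ∀ {t} (g : A → B) (f : Fin t → List A) → map g (Concat f) ≡ Concat (map g ∘ f)
map-Concat {t = zero}  g f = refl
map-Concat {t = suc t} g f = trans (map-++ g (f fzero) _) (cong (map g (f fzero) ++_) (map-Concat g (f ∘ fsuc)))

∈-Concat : ∀ {t} (f : Fin t → List A) i {x} → x ∈ f i → x ∈ Concat f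
∈-Concat f fzero    x∈ = ∈-++⁺ˡ x∈
∈-Concat f (fsuc i) x∈ = ∈-++⁺ʳ (f fzero) (∈-Concat (f ∘ fsuc) i x∈)

⊆-Concat : ∀ {t} {f g : Fin t → List A} → (∀ i → f i ⊆ g i) → Concat f ⊆ Concat g
⊆-Concat {t = zero}  sub = []
⊆-Concat {t = suc t} sub = Sublist.++⁺ (sub fzero) (⊆-Concat (sub ∘ fsuc))

⊑-Concat : ∀ {t} {m m′ : Fin t → List Bool} → (∀ i → m i ⊑ m′ i) → Concat m ⊑ Concat m′
⊑-Concat {t = zero}  le = []
⊑-Concat {t = suc t} le = Pointwise.++⁺ (le fzero) (⊑-Concat (le ∘ fsuc))

select-Concat : ∀ {t} (m : Fin t → List Bool) (f : Fin t → List A) → (∀ i → length (m i) ≡ length (f i)) →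
  select (Concat m) (Concat f) ≡ Concat (λ i → select (m i) (f i))
select-Concat {t = zero}  m f len = refl
select-Concat {t = suc t} m f len =
  trans (select-++ (m fzero) _ (f fzero) _ (len fzero))
        (cong (select (m fzero) (f fzero) ++_) (select-Concat (m ∘ fsuc) (f ∘ fsuc) (len ∘ fsuc)))

split-at : ∀ n k (M : List A) → length M ≡ n + k →
  Σ (List A) λ M₁ → Σ (List A) λ M₂ → M ≡ M₁ ++ M₂ × length M₁ ≡ n × length M₂ ≡ k
split-at zero    k M       len = [] , M , refl , refl , len
split-at (suc n) k (b ∷ M) len with split-at n k M (suc-injective len)
... | M₁ , M₂ , refl , len₁ , len₂ = b ∷ M₁ , M₂ , refl , cong suc len₁ , len₂

split-mask : ∀ {t} (f : Fin t → List A) (M : List Bool) → length M ≡ length (Concat f) →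
  Σ (Fin t → List Bool) λ m → (∀ i → length (m i) ≡ length (f i)) × M ≡ Concat m
split-mask {t = zero}  f [] _ = (λ ()) , (λ ()) , refl
split-mask {t = suc t} f M len
  with split-at (length (f fzero)) _ M (trans len (length-++ (f fzero)))
... | M₁ , M₂ , refl , len₁ , len₂ with split-mask (f ∘ fsuc) M₂ len₂
...   | m , m-length , refl = M₁ ∷ᶠ m , (λ { fzero → len₁ ; (fsuc i) → m-length i }) , refl

not-nonempty : {xs : List A} → ¬ (1 ≤ length xs) → xs ≡ []
not-nonempty {xs = []}    _     = refl
not-nonempty {xs = _ ∷ _} empty = contradiction (s≤s z≤n) empty

Concat-empty : ∀ {t} (f : Fin t → List A) → (∀ i → ¬ (1 ≤ length (f i))) → Concat f ≡ []
Concat-empty {t = zero}  f empty = refl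
Concat-empty {t = suc t} f empty =
  cong₂ _++_ (not-nonempty (empty fzero)) (Concat-empty (f ∘ fsuc) (empty ∘ fsuc))

Concat-single : ∀ {t} (f : Fin t → List A) → (∀ i j → 1 ≤ length (f i) → 1 ≤ length (f j) → i ≡ j) →
  Concat f ≡ [] ⊎ Σ (Fin t) λ i → Concat f ≡ f i
Concat-single {t = zero}  f one = inj₁ refl
Concat-single {t = suc t} f one with 1 ≤? length (f fzero)
... | yes first =
  inj₂ (fzero , trans (cong (f fzero ++_) (Concat-empty (f ∘ fsuc) others-empty)) (++-identityʳ (f fzero)))
  where
  others-empty : ∀ i → ¬ (1 ≤ length (f (fsuc i)))
  others-empty i other = Fin.0≢1+n (one fzero (fsuc i) first other)
... | no empty with Concat-single (f ∘ fsuc) (λ i j p q → Fin.suc-injective (one (fsuc i) (fsuc j) p q))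
...   | inj₁ e       = inj₁ (trans (cong (_++ Concat (f ∘ fsuc)) (not-nonempty empty)) e)
...   | inj₂ (i , e) = inj₂ (fsuc i , trans (cong (_++ Concat (f ∘ fsuc)) (not-nonempty empty)) e)

sum-mono : ∀ {t} {f g : Fin t → ℕ} → (∀ i → f i ≤ g i) → sum f ≤ sum g
sum-mono {t = zero}  le = z≤n
sum-mono {t = suc t} le = +-mono-≤ (le fzero) (sum-mono (le ∘ fsuc))

positive : ℕ → ℕ
positive zero    = 0
positive (suc _) = 1

positive-suc : ∀ {n} → 1 ≤ n → positive n ≡ 1
positive-suc {suc _} _ = refl

positive-≤ : ∀ n → positive n ≤ n
positive-≤ zero    = z≤n
positive-≤ (suc n) = s≤s z≤n

sum-positive : ∀ {t} (f : Fin t → ℕ) → 1 ≤ sum f → 1 ≤ sum (positive ∘ f)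
sum-positive {t = suc t} f le with f fzero
... | suc _ = s≤s z≤n
... | zero  = sum-positive (f ∘ fsuc) le

positive-term : ∀ {t} (f : Fin t → ℕ) i → 1 ≤ f i → 1 ≤ sum (positive ∘ f)
positive-term f fzero    le = ≤-trans (≤-reflexive (sym (positive-suc le))) (m≤m+n _ _)
positive-term f (fsuc i) le = ≤-trans (positive-term (f ∘ fsuc) i le) (m≤n+m _ (positive (f fzero)))

at-most-one-positive : ∀ {t} (f : Fin t → ℕ) → sum (positive ∘ f) ≤ 1 →
  ∀ i j → 1 ≤ f i → 1 ≤ f j → i ≡ j
at-most-one-positive f ≤1 fzero    fzero    _   _   = refl
at-most-one-positive f ≤1 fzero    (fsuc j) f0 fj = contradiction ≤1 (two-terms f0 (positive-term (f ∘ fsuc) j fj))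
  where
  two-terms : ∀ {a b} → 1 ≤ a → 1 ≤ b → ¬ (positive a + b ≤ 1)
  two-terms (s≤s _) (s≤s _) (s≤s ())
at-most-one-positive f ≤1 (fsuc i) fzero    fi f0 = sym (at-most-one-positive f ≤1 fzero (fsuc i) f0 fi)
at-most-one-positive f ≤1 (fsuc i) (fsuc j) fi fj =
  cong fsuc (at-most-one-positive (f ∘ fsuc) (≤-trans (m≤n+m _ (positive (f fzero))) ≤1) i j fi fj)

sum-estimate : ∀ {t} k (c j z : Fin t → ℕ) → (∀ i → c i + positive (j i) * k ≤ j i * suc k + z i) →
  sum c + sum (positive ∘ j) * k ≤ sum j * suc k + sum z
sum-estimate k c j z est = begin
  sum c + sum (positive ∘ j) * k              ≡⟨ cong (sum c +_) (*-distribʳ-sum k (positive ∘ j)) ⟩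
  sum c + sum (λ i → positive (j i) * k)      ≡⟨ ∑-distrib-+ c (λ i → positive (j i) * k) ⟨
  sum (λ i → c i + positive (j i) * k)        ≤⟨ sum-mono est ⟩
  sum (λ i → j i * suc k + z i)               ≡⟨ ∑-distrib-+ (λ i → j i * suc k) z ⟩
  sum (λ i → j i * suc k) + sum z             ≡⟨ cong (_+ sum z) (*-distribʳ-sum (suc k) j) ⟨
  sum j * suc k + sum z                       ∎
  where open ≤-Reasoning

module Realizability (𝒯 : List Template) where

  InS⇒IsPerm : ∀ {n π} → InS 𝒯 n π → IsPerm n π
  InS⇒IsPerm s0                        = ↭-refl
  InS⇒IsPerm s1                        = ↭-refl
  InS⇒IsPerm (sT _ perm _ _ _ _ _ _ _) = perm

  Realizable : List ℕ → Set
  Realizable w = Σ (List ℕ) λ σ → w ≅ σ × InS 𝒯 (length w) σ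

  BlockCondition : List ℕ → Set
  BlockCondition w = Σ (List ℕ) λ σ → IsPerm (length w) σ × OrdIso w σ × InS 𝒯 (length w) σ

  block⇒realizable : ∀ {w} → BlockCondition w → Realizable w
  block⇒realizable (σ , _ , w≅σ , inS) = σ , OrdIso⇒≅ w≅σ , inS

  realizable⇒block : ∀ {w} → Realizable w → BlockCondition w
  realizable⇒block (σ , w≅σ , inS) = σ , InS⇒IsPerm inS , ≅⇒OrdIso w≅σ , inS

  realizable-[] : Realizable []
  realizable-[] = [] , ≅-refl [] , s0

  realizable-≅ : ∀ {u v} → u ≅ v → Realizable v → Realizable u
  realizable-≅ u≅v (σ , v≅σ , inS) =
    σ , ≅-trans u≅v v≅σ , subst (λ n → InS 𝒯 n σ) (sym (≅-length u≅v)) inS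

  Ordered : (T : Template) → Vec (List ℕ) (Template.t T) → Set
  Ordered T W = ∀ i j → vlookup (Template.P T) i > vlookup (Template.P T) j →
    All (λ x → All (λ y → y < x) (vlookup W j)) (vlookup W i)

  -- Its pattern is
  -- the standardisation by ranks, cut into the blocks rank(ρ_i).
  assemble : (T : Template) → T ∈ 𝒯 → (W : Vec (List ℕ) (Template.t T)) →
    Unique (concat (toList W)) → Ordered T W →
    (ρ : Fin (Template.t T) → List ℕ) → (∀ i → ρ i ⊆ vlookup W i) → (∀ i → Realizable (ρ i)) →
    (∀ i → vlookup (Template.B T) i ≡ false → length (ρ i) ≡ 1) → 2 ≤ length (Concat ρ) →
    Realizable (Concat ρ)
  assemble T T∈ W uniqueW ordered ρ ρ⊆W realizable bits two =
    map r w , ≅-map r w (rank-embedding w) ,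
    sT two (rank-perm w unique) T T∈ W′ concat-W′ ordered′ blocks′ bits′
    where
    w = Concat ρ
    r = rank w
    unique : Unique w
    unique = Unique-⊆ (subst (w ⊆_) (sym (concat-toList W)) (⊆-Concat ρ⊆W)) uniqueW
    embedding : ∀ i → EmbeddingOn r (ρ i)
    embedding i = EmbeddingOn-⊆ (∈-Concat ρ i) (rank-embedding w)
    W′ = tabulate (λ i → map r (ρ i))
    W′-at : ∀ i → vlookup W′ i ≡ map r (ρ i)
    W′-at = lookup∘tabulate (λ i → map r (ρ i))
    concat-W′ : concat (toList W′) ≡ map r w
    concat-W′ = trans (concat-toList W′) (trans (Concat-cong W′-at) (sym (map-Concat r ρ)))
    ordered′ : Ordered T W′
    ordered′ i j P>P rewrite W′-at i | W′-at j =
      All.map⁺ (All.tabulate λ a∈ → All.map⁺ (All.tabulate λ b∈ → rank-below a∈ b∈))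
      where
      -- the blocks W_i, W_j are ordered, and r is strictly monotone on w
      rank-below : ∀ {a b} → a ∈ ρ i → b ∈ ρ j → r b < r a
      rank-below a∈ b∈ = proj₁ (rank-embedding w (∈-Concat ρ j b∈) (∈-Concat ρ i a∈))
        (All.lookup (All.lookup (ordered i j P>P) (Any-resp-⊆ (ρ⊆W i) a∈)) (Any-resp-⊆ (ρ⊆W j) b∈))
    blocks′ : ∀ i → BlockCondition (vlookup W′ i)
    blocks′ i rewrite W′-at i =
      realizable⇒block (realizable-≅ (≅-sym (≅-map r (ρ i) (embedding i))) (realizable i))
    bits′ : ∀ i → vlookup (Template.B T) i ≡ false → length (vlookup W′ i) ≡ 1
    bits′ i b≡0 rewrite W′-at i = trans (length-map r (ρ i)) (bits i b≡0)

-- The arithmetic behind the size estimate: if the k saved by the extension plus the padding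
-- Z is covered by the U·k saved in the blocks, the total saving is at least k.
budget : ∀ {c U X Z} k → k + Z ≤ U * k → c + U * k ≤ X + Z → c + k ≤ X
budget {c} {U} {X} {Z} k covered est = +-cancelʳ-≤ Z (c + k) X (begin
  c + k + Z    ≡⟨ +-assoc c k Z ⟩
  c + (k + Z)  ≤⟨ +-monoʳ-≤ c covered ⟩
  c + U * k    ≤⟨ est ⟩
  X + Z        ∎)
  where open ≤-Reasoning

zeroBit : Bool → ℕ
zeroBit false = 1
zeroBit true  = 0

zeros-sum : ∀ {t} (B : Vec Bool t) → zeros (toList B) ≡ sum (zeroBit ∘ vlookup B)
zeros-sum []ᵛ          = refl
zeros-sum (false ∷ᵛ B) = cong suc (zeros-sum B)
zeros-sum (true  ∷ᵛ B) = zeros-sum B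

module MainLemma (𝒯 : List Template) (k : ℕ)
                 (few-zeros : All (λ T → zeros (toList (Template.B T)) ≤ k) 𝒯) where
  open Realizability 𝒯

  record Extension (π : List ℕ) (M : List Bool) : Set where
    constructor extension
    field
      mask        : List Bool
      mask-length : length mask ≡ length π
      grows       : M ⊑ mask
      bounded     : length (select mask π) + k ≤ length (select M π) * suc k
      realizable  : Realizable (select mask π)

  extension-≅ : ∀ {w π M} → w ≅ π → Extension π M → Extension w M
  extension-≅ {M = M} w≅π (extension m len grows bounded real) =
    extension m (trans len (sym (≅-length w≅π))) grows
      (subst₂ (λ a b → a + k ≤ b * suc k)
        (sym (≅-length (≅-select m w≅π))) (sym (≅-length (≅-select M w≅π))) bounded)
      (realizable-≅ (≅-select m w≅π) real)

  record BlockChoice (Wi : List ℕ) (mi : List Bool) (z : ℕ) : Set where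
    constructor choice
    field
      mask        : List Bool
      mask-length : length mask ≡ length Wi
      grows       : mi ⊑ mask
      realizable  : Realizable (select mask Wi)
      estimate    : length (select mask Wi) + positive (length (select mi Wi)) * k
                      ≤ length (select mi Wi) * suc k + z

  extended : ∀ {Wi mi} → 1 ≤ length (select mi Wi) → Extension Wi mi → BlockChoice Wi mi 0
  extended {Wi} {mi} j≥1 (extension m len grows bounded real) = choice m len grows real (begin
    length (select m Wi) + positive j * k   ≡⟨ cong (λ p → length (select m Wi) + p * k) (positive-suc j≥1) ⟩
    length (select m Wi) + 1 * k            ≡⟨ cong (length (select m Wi) +_) (*-identityˡ k) ⟩
    length (select m Wi) + k                ≤⟨ bounded ⟩
    j * suc k                               ≡⟨ +-identityʳ (j * suc k) ⟨
    j * suc k + 0                           ∎)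
    where
    open ≤-Reasoning
    j = length (select mi Wi)

  kept : ∀ {Wi mi} → length mi ≡ length Wi → select mi Wi ≡ [] → BlockChoice Wi mi 0
  kept {Wi} {mi} len empty = choice mi len (⊑-refl mi) (subst Realizable (sym empty) realizable-[])
    (subst (λ s → length s + positive (length s) * k ≤ length s * suc k + 0) (sym empty) z≤n)

  filled : ∀ {Wi mi} → length mi ≡ length Wi → select mi Wi ≡ [] → length Wi ≡ 1 → BlockCondition Wi →
    BlockChoice Wi mi 1
  filled {Wi} {mi} len empty single block =
    choice (full (length Wi)) (length-replicate (length Wi)) (subst (λ n → mi ⊑ full n) len (⊑-full mi))
      (subst Realizable (sym (select-full Wi)) (block⇒realizable block))
      (subst₂ (λ s w → length w + positive (length s) * k ≤ length s * suc k + 1) (sym empty) (sym (select-full Wi))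
        (≤-reflexive (trans (+-identityʳ (length Wi)) single)))

  zero-bit-choice : ∀ {Wi mi z} → length Wi ≡ 1 → 1 ≤ length (select mi Wi) → (ch : BlockChoice Wi mi z) →
    length (select (BlockChoice.mask ch) Wi) ≡ 1
  zero-bit-choice {Wi} single j≥1 ch = ≤-antisym
    (subst (length (select m Wi) ≤_) single (length-mono-≤ (select-⊆ m Wi)))
    (≤-trans j≥1 (length-mono-≤ (select-⊑ (BlockChoice.grows ch) Wi)))
    where m = BlockChoice.mask ch

  relax : ∀ {Wi mi z z′} → z ≤ z′ → BlockChoice Wi mi z → BlockChoice Wi mi z′
  relax {Wi} {mi} z≤z′ (choice m len grows real est) =
    choice m len grows real (≤-trans est (+-monoʳ-≤ (length (select mi Wi) * suc k) z≤z′))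

  module Step {n} (T : Template) (T∈ : T ∈ 𝒯) (W : Vec (List ℕ) (Template.t T))
              (perm : IsPerm n (concat (toList W))) (ordered : Ordered T W)
              (blocks : ∀ i → BlockCondition (vlookup W i))
              (bits : ∀ i → vlookup (Template.B T) i ≡ false → length (vlookup W i) ≡ 1)
              (recurse : ∀ i m → length m ≡ length (vlookup W i) → 1 ≤ length (select m (vlookup W i)) →
                           Extension (vlookup W i) m)
              (m : Fin (Template.t T) → List Bool) (m-length : ∀ i → length (m i) ≡ length (vlookup W i)) where

    Bits = Template.B T

    j : Fin (Template.t T) → ℕ
    j i = length (select (m i) (vlookup W i))

    U : ℕ
    U = sum (positive ∘ j)

    selected-count : length (select (Concat m) (Concat (vlookup W))) ≡ sum j
    selected-count = trans (cong length (select-Concat m (vlookup W) m-length))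
                           (length-Concat (λ i → select (m i) (vlookup W i)))

    Choices : (Fin (Template.t T) → ℕ) → Set
    Choices z = ∀ i → BlockChoice (vlookup W i) (m i) (z i)

    chosen : ∀ {z} → Choices z → Fin (Template.t T) → List ℕ
    chosen ch i = select (BlockChoice.mask (ch i)) (vlookup W i)

    combine : ∀ {z} (ch : Choices z) → Realizable (Concat (chosen ch)) →
      sum (length ∘ chosen ch) + k ≤ sum j * suc k → Extension (Concat (vlookup W)) (Concat m)
    combine ch real bound =
      extension (Concat masks) (length-Concat-cong (BlockChoice.mask-length ∘ ch)) (⊑-Concat (BlockChoice.grows ∘ ch))
        (subst₂ (λ a b → a + k ≤ b * suc k)
          (sym (trans (cong length selection) (length-Concat (chosen ch)))) (sym selected-count) bound)
        (subst Realizable (sym selection) real)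
      where
      masks = BlockChoice.mask ∘ ch
      selection : select (Concat masks) (Concat (vlookup W)) ≡ Concat (chosen ch)
      selection = select-Concat masks (vlookup W) (BlockChoice.mask-length ∘ ch)

    estimate : ∀ {z} (ch : Choices z) →
      sum (length ∘ chosen ch) + U * k ≤ sum j * suc k + sum z
    estimate {z} ch = sum-estimate k (length ∘ chosen ch) j z (BlockChoice.estimate ∘ ch)

    chosen-≥ : ∀ {z} (ch : Choices z) i → j i ≤ length (chosen ch i)
    chosen-≥ ch i = length-mono-≤ (select-⊑ (BlockChoice.grows (ch i)) (vlookup W i))

    multi-choice : ∀ i → Σ (BlockChoice (vlookup W i) (m i) (zeroBit (vlookup Bits i))) λ ch →
      vlookup Bits i ≡ false → length (select (BlockChoice.mask ch) (vlookup W i)) ≡ 1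
    multi-choice i with 1 ≤? j i
    ... | yes j≥1 = relax z≤n ch , λ b≡0 → zero-bit-choice (bits i b≡0) j≥1 ch
      where ch = extended j≥1 (recurse i (m i) (m-length i) j≥1)
    ... | no  j≱1 with vlookup Bits i in b≡
    ...   | false = filled (m-length i) (not-nonempty j≱1) (bits i b≡) (blocks i) ,
                    λ _ → trans (cong length (select-full (vlookup W i))) (bits i b≡)
    ...   | true  = kept (m-length i) (not-nonempty j≱1) , λ ()

    multi : 2 ≤ U → Extension (Concat (vlookup W)) (Concat m)
    multi U≥2 = combine ch (assemble T T∈ W unique ordered (chosen ch) (λ i → select-⊆ _ _)
                              (BlockChoice.realizable ∘ ch) (proj₂ ∘ multi-choice) two)
                  (budget {U = U} k covered (estimate ch))
      where
      ch = proj₁ ∘ multi-choice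
      unique : Unique (concat (toList W))
      unique = perm-unique perm
      two : 2 ≤ length (Concat (chosen ch))
      two = ≤-trans U≥2 (≤-trans (sum-mono (positive-≤ ∘ j))
              (≤-trans (sum-mono (chosen-≥ ch)) (≤-reflexive (sym (length-Concat (chosen ch))))))
      covered : k + sum (zeroBit ∘ vlookup Bits) ≤ U * k
      covered = begin
        k + sum (zeroBit ∘ vlookup Bits)  ≡⟨ cong (k +_) (zeros-sum Bits) ⟨
        k + zeros (toList Bits)           ≤⟨ +-monoʳ-≤ k (All.lookup few-zeros T∈) ⟩
        k + k                             ≡⟨ cong (k +_) (+-identityʳ k) ⟨
        2 * k                             ≤⟨ *-monoˡ-≤ k U≥2 ⟩
        U * k                             ∎
        where open ≤-Reasoning

    single-choice : ∀ i → Σ (BlockChoice (vlookup W i) (m i) 0) λ ch →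
      1 ≤ length (select (BlockChoice.mask ch) (vlookup W i)) → 1 ≤ j i
    single-choice i with 1 ≤? j i
    ... | yes j≥1 = extended j≥1 (recurse i (m i) (m-length i) j≥1) , λ _ → j≥1
    ... | no  j≱1 = kept (m-length i) (not-nonempty j≱1) , id

    single : U ≤ 1 → 1 ≤ sum j → Extension (Concat (vlookup W)) (Concat m)
    single U≤1 j≥1 = combine ch realizable (budget {U = U} k covered (estimate {z = λ _ → 0} ch))
      where
      ch : Choices (λ _ → 0)
      ch = proj₁ ∘ single-choice
      at-most-one : ∀ i i′ → 1 ≤ length (chosen ch i) → 1 ≤ length (chosen ch i′) → i ≡ i′
      at-most-one i i′ c≥1 c′≥1 =
        at-most-one-positive j U≤1 i i′ (proj₂ (single-choice i) c≥1) (proj₂ (single-choice i′) c′≥1)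
      realizable : Realizable (Concat (chosen ch))
      realizable with Concat-single (chosen ch) at-most-one
      ... | inj₁ empty    = subst Realizable (sym empty) realizable-[]
      ... | inj₂ (i , eq) = subst Realizable (sym eq) (BlockChoice.realizable (ch i))
      covered : k + sum {Template.t T} (λ _ → 0) ≤ U * k
      covered = begin
        k + sum {Template.t T} (λ _ → 0)  ≡⟨ cong (k +_) (sum-replicate-zero (Template.t T)) ⟩
        k + 0                             ≡⟨ +-identityʳ k ⟩
        k                                 ≡⟨ *-identityˡ k ⟨
        1 * k                             ≤⟨ *-monoˡ-≤ k (sum-positive j j≥1) ⟩
        U * k                             ∎
        where open ≤-Reasoning

    step : 1 ≤ sum j → Extension (Concat (vlookup W)) (Concat m)
    step j≥1 with 2 ≤? U
    ... | yes U≥2 = multi U≥2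
    ... | no  U≱2 = single (≤-pred (≰⇒> U≱2)) j≥1

  template-step : ∀ {n} (T : Template) → T ∈ 𝒯 → (W : Vec (List ℕ) (Template.t T)) →
    IsPerm n (concat (toList W)) → Ordered T W → (∀ i → BlockCondition (vlookup W i)) →
    (∀ i → vlookup (Template.B T) i ≡ false → length (vlookup W i) ≡ 1) →
    (∀ i m → length m ≡ length (vlookup W i) → 1 ≤ length (select m (vlookup W i)) → Extension (vlookup W i) m) →
    ∀ M → length M ≡ length (concat (toList W)) → 1 ≤ length (select M (concat (toList W))) →
    Extension (concat (toList W)) M
  template-step T T∈ W perm ordered blocks bits recurse M len sel
    with split-mask (vlookup W) M (trans len (cong length (concat-toList W)))
  ... | m , m-length , refl = subst (λ π → Extension π (Concat m)) (sym (concat-toList W)) (step j≥1)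
    where
    open Step T T∈ W perm ordered blocks bits recurse m m-length
    j≥1 : 1 ≤ sum j
    j≥1 = subst (1 ≤_) (trans (cong (λ π → length (select (Concat m) π)) (concat-toList W)) selected-count) sel

  -- By induction on the derivation; blocks
  -- are handled through their order-isomorphic members of S.
  extend : ∀ {n π} → InS 𝒯 n π → ∀ M → length M ≡ length π → 1 ≤ length (select M π) → Extension π M
  extend s0 []           _  ()
  extend s1 []           () _
  extend s1 (false ∷ []) _  ()
  extend s1 (true  ∷ []) _  _ =
    extension (true ∷ []) refl (⊑-refl _) (≤-reflexive (sym (*-identityˡ (suc k)))) (1 ∷ [] , ≅-refl _ , s1)
  extend s1 (_ ∷ _ ∷ _)  () _
  extend (sT _ perm T T∈ W refl ordered blocks bits) = template-step T T∈ W perm ordered blocks bits recurse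
    where
    recurse : ∀ i m → length m ≡ length (vlookup W i) → 1 ≤ length (select m (vlookup W i)) →
      Extension (vlookup W i) m
    recurse i m m-length m-sel with blocks i
    ... | σ , _ , Wi≃σ , σ∈S = extension-≅ Wi≅σ
      (extend σ∈S m (trans m-length (≅-length Wi≅σ)) (subst (1 ≤_) (≅-length (≅-select m Wi≅σ)) m-sel))
      where
      Wi≅σ : vlookup W i ≅ σ
      Wi≅σ = OrdIso⇒≅ Wi≃σ

Contains-≅ : ∀ {ρ ρ′ σ} → ρ ≅ ρ′ → Contains ρ σ → Contains ρ′ σ
Contains-≅ {ρ} {ρ′} {σ} ρ≅ρ′ (τ , τ⊆ρ , τ≅σ) with ⊆⇒select τ⊆ρ
... | N , _ , refl =
  select N ρ′ , select-⊆ N ρ′ , ≅⇒OrdIso (≅-trans (≅-sym (≅-select N ρ≅ρ′)) τ≅σ′)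
  where
  τ≅σ′ : select N ρ ≅ σ
  τ≅σ′ = OrdIso⇒≅ τ≅σ

IsPerm-length : ∀ {n π} → IsPerm n π → length π ≡ n
IsPerm-length {n} perm = trans (↭-length perm) (trans (length-map suc (upTo n)) (length-upTo n))

-- (k+1)·(l+1) − k = (k+1)·l + 1.
final-bound : ∀ {c} k l → c + k ≤ suc l * suc k → c ≤ l * (k + 1) + 1
final-bound {c} k l le = +-cancelʳ-≤ k c (l * (k + 1) + 1) (begin
  c + k                 ≤⟨ le ⟩
  suc k + l * suc k     ≡⟨ cong (λ s → s + l * s) (+-comm 1 k) ⟩
  k + 1 + l * (k + 1)   ≡⟨ +-comm (k + 1) (l * (k + 1)) ⟩
  l * (k + 1) + (k + 1) ≡⟨ cong (l * (k + 1) +_) (+-comm k 1) ⟩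
  l * (k + 1) + (1 + k) ≡⟨ +-assoc (l * (k + 1)) 1 k ⟨
  l * (k + 1) + 1 + k   ∎)
  where open ≤-Reasoning

theorem6 : (𝒯 : List Template) (k : ℕ) →
    All (λ T → zeros (toList (Template.B T)) ≤ k) 𝒯 →
    (l : ℕ) → 0 < l → (σ : List ℕ) → IsPerm l σ →
    (∃[ n ] ∃[ π ] (InS 𝒯 n π × Contains π σ)) →
    ∃[ m ] (m ≤ (l ∸ 1) * (k + 1) + 1 × ∃[ π ] (InS 𝒯 m π × Contains π σ))
theorem6 _ _ _ zero () _ _ _
theorem6 𝒯 k few-zeros (suc l) _ σ σ-perm (n , π , π∈S , τ , τ⊆π , τ≅σ) with ⊆⇒select τ⊆π
... | M , M-length , refl =
  length ρ , final-bound k l (subst (λ j → length ρ + k ≤ j * suc k) τ-length bounded) ,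
  σ′ , σ′∈S , Contains-≅ {σ = σ} ρ≅σ′ (τ , select-⊑ grows π , τ≅σ)
  where
  open MainLemma 𝒯 k few-zeros
  τ-length : length (select M π) ≡ suc l
  τ-length = trans (proj₁ τ≅σ) (IsPerm-length σ-perm)
  open Extension (extend π∈S M M-length (subst (1 ≤_) (sym τ-length) (s≤s z≤n)))
  ρ = select mask π
  σ′ = proj₁ realizable
  ρ≅σ′ = proj₁ (proj₂ realizable)
  σ′∈S = proj₂ (proj₂ realizable)
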